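{- Let $N>1$ be an integer and $s,r\in\mathbb{N}$. The number of pairs $(a,b)\in\{1,\dots,N\}^2$ such that \[ \frac{b\,(s\,t^2+r\,t)}{s\,a^2+r\,a}\notin\mathbb{Z}\quad\text{for all integers } 1\le t<a \] equals \[ \sum_{a=1}^{N}\ \sum_{J\subseteq\{1,\dots,a-1\}}(-1)^{|J|}\left\lfloor\frac{N}{\operatorname{lcm}(m_{a,t}:t\in J)}\right\rfloor, \qquad\text{where}\qquad m_{a,t}=\frac{a\,(s\,a+r)}{\gcd\bigl(a\,(s\,a+r),\,t\,(s\,t+r)\bigr)}. \]
   Context: $\mathbb{N}=\{1,2,3,\dots\}$. The lcm over the empty index set $J=\varnothing$ is taken to be $1$. -}

module Defs where

open import Data.Nat using (ℕ; zero; suc; _+_; _*_)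
open import Data.Nat.Divisibility using (_∣_; _∣?_)
open import Data.Nat.DivMod using (_/_)
open import Data.Nat.GCD using (gcd)
open import Data.Nat.LCM using (lcm)
open import Data.Integer as ℤ using (ℤ)
open import Data.List using (List; []; _∷_; length; filter; map; foldr; sum; cartesianProduct)
open import Data.List.Base using (upTo)
open import Data.Product using (_×_; _,_)
open import Relation.Nullary using (¬_; Dec)
open import Relation.Nullary.Decidable using (¬?)
open import Data.List.Relation.Unary.All using (All; all?)

-- total floor division: ⌊ m / d ⌋ for d ≥ 1, and 0 when d = 0
-- (d = 0 never occurs in the statement, since s, r, a ≥ 1)
_div_ : ℕ → ℕ → ℕ
m div zero = 0
m div suc d = m / suc d

range1 : ℕ → List ℕ
range1 n = map suc (upTo n)

subsets : List ℕ → List (List ℕ)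
subsets [] = [] ∷ []
subsets (x ∷ xs) = let ys = subsets xs in ys Data.List.++ map (x ∷_) ys

lcmList : List ℕ → ℕ
lcmList = foldr lcm 1

f : ℕ → ℕ → ℕ → ℕ
f s r x = x * (s * x + r)

m : ℕ → ℕ → ℕ → ℕ → ℕ
m s r a t = f s r a div gcd (f s r a) (f s r t)

sign : ℕ → ℤ
sign zero = ℤ.+ 1
sign (suc k) = ℤ.- sign k

-- the condition: for all 1 ≤ t < a,  b (s t² + r t) / (s a² + r a) ∉ ℤ,
-- i.e. (s a² + r a) does not divide b (s t² + r t)
Good : ℕ → ℕ → ℕ × ℕ → Set
Good s r (a , b) = All (λ t → ¬ (f s r a ∣ b * f s r t)) (range1 (a Data.Nat.∸ 1))

good? : ∀ s r p → Dec (Good s r p)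
good? s r (a , b) = all? (λ t → ¬? (f s r a ∣? (b * f s r t))) (range1 (a Data.Nat.∸ 1))

count : ℕ → ℕ → ℕ → ℕ
count N s r = length (filter (good? s r) (cartesianProduct (range1 N) (range1 N)))

sumℤ : List ℤ → ℤ
sumℤ = foldr ℤ._+_ (ℤ.+ 0)

formula : ℕ → ℕ → ℕ → ℤ
formula N s r =
  sumℤ (map (λ a →
    sumℤ (map (λ J → sign (length J) ℤ.* ℤ.+ (N div lcmList (map (m s r a) J)))
              (subsets (range1 (a Data.Nat.∸ 1)))))
    (range1 N))

-- For a fixed a, the condition on b says that b avoids the multiples of every
-- m_{a,t}: since a(sa+r)/g and t(st+r)/g are coprime for g their gcd,
-- a(sa+r) ∣ b·t(st+r) holds exactly when m_{a,t} ∣ b. Inclusion–exclusion over the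
-- set of t then counts such b ∈ {1..N} through the number ⌊N/lcm(m_{a,t} : t ∈ J)⌋
-- of common multiples, and summing over a gives the formula.
module Submission where

open import Defs
open import Data.Nat using (ℕ; _<_; _≤_)
open import Data.Integer using (+_)
open import Relation.Binary.PropositionalEquality using (_≡_)

open import Data.Bool.Base using (true; false)
open import Data.Nat.Base using (zero; suc; _+_; _*_; _∸_; NonZero; ≢-nonZero; ≢-nonZero⁻¹; >-nonZero)
import Data.Nat.Properties as ℕ
open import Data.Nat.Divisibility
  using (_∣_; _∣?_; divides; ∣-trans; ∣m+n∣m⇒∣n; n∣m*n; ∣⇒≤; *-monoʳ-∣; m/n∣o⇒m∣o*n; m∣n*o⇒m/n∣o; 1∣_; 0∣⇒≡0)
open import Data.Nat.DivMod using (_/_; _%_; m≡m%n+[m/n]*n; m%n<n; m/n*n≡m; m*n/n≡m; m<n⇒m/n≡0; /-congˡ; +-distrib-/-∣ʳ)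
open import Data.Nat.GCD using (gcd; gcd[m,n]∣m; gcd[m,n]∣n; gcd[m,n]≢0)
open import Data.Nat.LCM using (lcm-least; m∣lcm[m,n]; n∣lcm[m,n])
open import Data.Nat.Coprimality using (coprime-/gcd; coprime-divisor)
open import Data.Integer.Base as ℤ using (ℤ)
import Data.Integer.Properties as ℤ
open import Data.List.Base using (List; []; _∷_; _++_; length; filter; map; upTo; cartesianProduct)
open import Data.List.Properties using (filter-≐; filter-++; length-++; length-map; map-++; map-∘; map-cong; upTo-∷ʳ)
open import Data.List.Relation.Unary.All as All using (All; []; _∷_; all?)
open import Data.Product using (_×_; _,_; swap)
open import Data.Sum using (inj₁; inj₂)
open import Function.Base using (_∘_)
open import Function.Bundles using (_⇔_; mk⇔; Equivalence)
open import Level using (0ℓ)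
open import Relation.Nullary using (¬_; yes; no; does; contradiction)
open import Relation.Nullary.Decidable using (¬?)
open import Relation.Unary using (Pred; Decidable; _∩_; _≐_)
open import Relation.Unary.Properties using (_∩?_; ∁?)
open import Relation.Binary.PropositionalEquality using (refl; sym; trans; cong; cong₂; subst; module ≡-Reasoning)

open ≡-Reasoning

module _ {A : Set} {P : Pred A 0ℓ} (P? : Decidable P) where

  length-filter+length-filter-∁ : ∀ xs → length (filter P? xs) + length (filter (∁? P?) xs) ≡ length xs
  length-filter+length-filter-∁ [] = refl
  length-filter+length-filter-∁ (x ∷ xs) with P? x
  ... | yes _ = cong suc (length-filter+length-filter-∁ xs)
  ... | no _ = trans (ℕ.+-suc _ _) (cong suc (length-filter+length-filter-∁ xs))

  length-filter-++ : ∀ xs ys → length (filter P? (xs ++ ys)) ≡ length (filter P? xs) + length (filter P? ys)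
  length-filter-++ xs ys = trans (cong length (filter-++ P? xs ys)) (length-++ (filter P? xs))

  filter-map : {B : Set} (h : B → A) → ∀ xs → filter P? (map h xs) ≡ map h (filter (P? ∘ h) xs)
  filter-map h [] = refl
  filter-map h (x ∷ xs) with P? (h x)
  ... | yes _ = cong (h x ∷_) (filter-map h xs)
  ... | no _ = filter-map h xs

module _ {A : Set} {P Q : Pred A 0ℓ} (P? : Decidable P) (Q? : Decidable Q) where

  filter-filter : ∀ xs → filter Q? (filter P? xs) ≡ filter (P? ∩? Q?) xs
  filter-filter [] = refl
  filter-filter (x ∷ xs) with does (P? x)
  ... | false = filter-filter xs
  ... | true with does (Q? x)
  ...   | true = cong (x ∷_) (filter-filter xs)
  ...   | false = filter-filter xs

module _ {A : Set} {P Q : Pred A 0ℓ} (P? : Decidable P) (Q? : Decidable Q) where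

  filter-comm : ∀ xs → filter P? (filter Q? xs) ≡ filter Q? (filter P? xs)
  filter-comm xs = begin
    filter P? (filter Q? xs)  ≡⟨ filter-filter Q? P? xs ⟩
    filter (Q? ∩? P?) xs      ≡⟨ filter-≐ (Q? ∩? P?) (P? ∩? Q?) (swap , swap) xs ⟩
    filter (P? ∩? Q?) xs      ≡⟨ filter-filter P? Q? xs ⟨
    filter Q? (filter P? xs)  ∎

sumℤ-++ : ∀ xs ys → sumℤ (xs ++ ys) ≡ sumℤ xs ℤ.+ sumℤ ys
sumℤ-++ [] ys = sym (ℤ.+-identityˡ _)
sumℤ-++ (x ∷ xs) ys = trans (cong (ℤ._+_ x) (sumℤ-++ xs ys)) (sym (ℤ.+-assoc x _ _))

sumℤ-map-neg : ∀ xs → sumℤ (map ℤ.-_ xs) ≡ ℤ.- sumℤ xs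
sumℤ-map-neg [] = refl
sumℤ-map-neg (x ∷ xs) = trans (cong (ℤ._+_ (ℤ.- x)) (sumℤ-map-neg xs)) (sym (ℤ.neg-distrib-+ x _))

sumℤ-map-subsets-∷ : (h : List ℕ → ℤ) → ∀ d L →
  sumℤ (map h (subsets (d ∷ L))) ≡ sumℤ (map h (subsets L)) ℤ.+ sumℤ (map (h ∘ (d ∷_)) (subsets L))
sumℤ-map-subsets-∷ h d L = begin
  sumℤ (map h (subsets L ++ map (d ∷_) (subsets L)))
    ≡⟨ cong sumℤ (map-++ h (subsets L) _) ⟩
  sumℤ (map h (subsets L) ++ map h (map (d ∷_) (subsets L)))
    ≡⟨ sumℤ-++ (map h (subsets L)) _ ⟩
  sumℤ (map h (subsets L)) ℤ.+ sumℤ (map h (map (d ∷_) (subsets L)))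
    ≡⟨ cong (ℤ._+_ (sumℤ (map h (subsets L))) ∘ sumℤ) (map-∘ (subsets L)) ⟨
  sumℤ (map h (subsets L)) ℤ.+ sumℤ (map (h ∘ (d ∷_)) (subsets L)) ∎

+m≡+[m+n]-+n : ∀ m n → + m ≡ + (m + n) ℤ.- + n
+m≡+[m+n]-+n m n = begin
  + m                ≡⟨ cong +_ (ℕ.m+n∸n≡m m n) ⟨
  + (m + n ∸ n)      ≡⟨ ℤ.⊖-≥ (ℕ.m≤n+m n m) ⟨
  (m + n) ℤ.⊖ n      ≡⟨ ℤ.m-n≡m⊖n (m + n) n ⟨
  + (m + n) ℤ.- + n  ∎

module InclusionExclusion {A : Set} {P : ℕ → Pred A 0ℓ} (P? : ∀ i → Decidable (P i)) where

  AllOf NoneOf : List ℕ → Pred A 0ℓ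
  AllOf J x = All (λ i → P i x) J
  NoneOf L x = All (λ i → ¬ P i x) L

  allOf? : ∀ J → Decidable (AllOf J)
  allOf? J x = all? (λ i → P? i x) J

  noneOf? : ∀ L → Decidable (NoneOf L)
  noneOf? L x = all? (λ i → ¬? (P? i x)) L

  #AllOf #NoneOf : List ℕ → List A → ℕ
  #AllOf J xs = length (filter (allOf? J) xs)
  #NoneOf L xs = length (filter (noneOf? L) xs)

  signedCount : List A → List ℕ → ℤ
  signedCount xs J = sign (length J) ℤ.* + #AllOf J xs

  #AllOf-∷ : ∀ d J xs → #AllOf (d ∷ J) xs ≡ #AllOf J (filter (P? d) xs)
  #AllOf-∷ d J xs = cong length (begin
    filter (allOf? (d ∷ J)) xs          ≡⟨ filter-≐ (allOf? (d ∷ J)) (P? d ∩? allOf? J) split-∷ xs ⟩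
    filter (P? d ∩? allOf? J) xs        ≡⟨ filter-filter (P? d) (allOf? J) xs ⟨
    filter (allOf? J) (filter (P? d) xs) ∎)
    where
    split-∷ : AllOf (d ∷ J) ≐ (P d ∩ AllOf J)
    split-∷ = (λ { (p ∷ ps) → p , ps }) , (λ (p , ps) → p ∷ ps)

  #NoneOf-∷ : ∀ d L xs → #NoneOf L xs ≡ #NoneOf (d ∷ L) xs + #NoneOf L (filter (P? d) xs)
  #NoneOf-∷ d L xs = begin
    length ys
      ≡⟨ length-filter+length-filter-∁ (P? d) ys ⟨
    length (filter (P? d) ys) + length (filter (∁? (P? d)) ys)
      ≡⟨ ℕ.+-comm (length (filter (P? d) ys)) _ ⟩
    length (filter (∁? (P? d)) ys) + length (filter (P? d) ys)
      ≡⟨ cong₂ _+_ avoiding hitting ⟩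
    #NoneOf (d ∷ L) xs + #NoneOf L (filter (P? d) xs) ∎
    where
    ys = filter (noneOf? L) xs
    avoiding : length (filter (∁? (P? d)) ys) ≡ length (filter (noneOf? (d ∷ L)) xs)
    avoiding = cong length (trans (filter-filter (noneOf? L) (∁? (P? d)) xs)
      (filter-≐ (noneOf? L ∩? ∁? (P? d)) (noneOf? (d ∷ L))
        ((λ (ps , p) → p ∷ ps) , λ { (p ∷ ps) → ps , p }) xs))
    hitting : length (filter (P? d) ys) ≡ length (filter (noneOf? L) (filter (P? d) xs))
    hitting = cong length (filter-comm (P? d) (noneOf? L) xs)

  inclusion-exclusion : ∀ L xs → + #NoneOf L xs ≡ sumℤ (map (signedCount xs) (subsets L))
  inclusion-exclusion [] xs = begin
    + #NoneOf [] xs                ≡⟨ cong (+_ ∘ length) (filter-≐ (noneOf? []) (allOf? []) ((λ _ → []) , (λ _ → [])) xs) ⟩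
    + #AllOf [] xs                 ≡⟨ ℤ.*-identityˡ _ ⟨
    signedCount xs []              ≡⟨ ℤ.+-identityʳ _ ⟨
    sumℤ (signedCount xs [] ∷ [])  ∎
  inclusion-exclusion (d ∷ L) xs = begin
    + #NoneOf (d ∷ L) xs
      ≡⟨ +m≡+[m+n]-+n (#NoneOf (d ∷ L) xs) (#NoneOf L hits) ⟩
    + (#NoneOf (d ∷ L) xs + #NoneOf L hits) ℤ.- + #NoneOf L hits
      ≡⟨ cong (λ n → + n ℤ.- + #NoneOf L hits) (#NoneOf-∷ d L xs) ⟨
    + #NoneOf L xs ℤ.- + #NoneOf L hits
      ≡⟨ cong₂ ℤ._-_ (inclusion-exclusion L xs) (inclusion-exclusion L hits) ⟩
    sumℤ (map (signedCount xs) (subsets L)) ℤ.- sumℤ (map (signedCount hits) (subsets L))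
      ≡⟨ cong (ℤ._+_ (sumℤ (map (signedCount xs) (subsets L)))) with-d ⟨
    sumℤ (map (signedCount xs) (subsets L)) ℤ.+ sumℤ (map (signedCount xs ∘ (d ∷_)) (subsets L))
      ≡⟨ sumℤ-map-subsets-∷ (signedCount xs) d L ⟨
    sumℤ (map (signedCount xs) (subsets (d ∷ L))) ∎
    where
    hits = filter (P? d) xs
    adjoin : ∀ J → signedCount xs (d ∷ J) ≡ ℤ.- signedCount hits J
    adjoin J = trans (cong (λ n → ℤ.- sign (length J) ℤ.* + n) (#AllOf-∷ d J xs))
      (sym (ℤ.neg-distribˡ-* (sign (length J)) _))
    with-d : sumℤ (map (signedCount xs ∘ (d ∷_)) (subsets L)) ≡ ℤ.- sumℤ (map (signedCount hits) (subsets L))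
    with-d = trans (cong sumℤ (trans (map-cong adjoin (subsets L)) (map-∘ (subsets L))))
      (sumℤ-map-neg (map (signedCount hits) (subsets L)))

module _ {A B : Set} {P : Pred (A × B) 0ℓ} (P? : Decidable P) where

  length-filter-cartesianProduct : ∀ xs ys →
    + length (filter P? (cartesianProduct xs ys)) ≡ sumℤ (map (λ x → + length (filter (P? ∘ (x ,_)) ys)) xs)
  length-filter-cartesianProduct [] ys = refl
  length-filter-cartesianProduct (x ∷ xs) ys = begin
    + length (filter P? (map (x ,_) ys ++ cartesianProduct xs ys))
      ≡⟨ cong +_ (length-filter-++ P? (map (x ,_) ys) (cartesianProduct xs ys)) ⟩
    + (length (filter P? (map (x ,_) ys)) + length (filter P? (cartesianProduct xs ys)))
      ≡⟨ ℤ.pos-+ (length (filter P? (map (x ,_) ys))) _ ⟩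
    + length (filter P? (map (x ,_) ys)) ℤ.+ + length (filter P? (cartesianProduct xs ys))
      ≡⟨ cong₂ ℤ._+_ (cong +_ row) (length-filter-cartesianProduct xs ys) ⟩
    sumℤ (map (λ x → + length (filter (P? ∘ (x ,_)) ys)) (x ∷ xs)) ∎
    where
    row : length (filter P? (map (x ,_) ys)) ≡ length (filter (P? ∘ (x ,_)) ys)
    row = trans (cong length (filter-map P? (x ,_) ys)) (length-map (x ,_) (filter (P? ∘ (x ,_)) ys))

range1-suc : ∀ n → range1 (suc n) ≡ range1 n ++ suc n ∷ []
range1-suc n = trans (cong (map suc) (sym (upTo-∷ʳ n))) (map-++ suc (upTo n) (n ∷ []))

map-cong-range1 : {B : Set} {h h′ : ℕ → B} → (∀ k → h (suc k) ≡ h′ (suc k)) →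
  ∀ n → map h (range1 n) ≡ map h′ (range1 n)
map-cong-range1 eq n = trans (sym (map-∘ (upTo n))) (trans (map-cong eq (upTo n)) (map-∘ (upTo n)))

module _ (n d : ℕ) .{{_ : NonZero d}} where

  private
    decomposition : suc n ≡ suc (n % d) + n / d * d
    decomposition = cong suc (m≡m%n+[m/n]*n n d)

    block-end : suc (n % d) ≡ d → suc n ≡ suc (n / d) * d
    block-end eq = trans decomposition (cong (_+ n / d * d) eq)

  suc[n]/d≡suc[n/d] : d ∣ suc n → suc n / d ≡ suc (n / d)
  suc[n]/d≡suc[n/d] d∣ with ℕ.m≤n⇒m<n∨m≡n (m%n<n n d)
  ... | inj₁ lt = contradiction (∣⇒≤ d∣rem) (ℕ.<⇒≱ lt)
    where
    d∣rem : d ∣ suc (n % d)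
    d∣rem = ∣m+n∣m⇒∣n (subst (d ∣_) (trans decomposition (ℕ.+-comm (suc (n % d)) _)) d∣) (n∣m*n (n / d))
  ... | inj₂ eq = trans (/-congˡ (block-end eq)) (m*n/n≡m (suc (n / d)) d)

  suc[n]/d≡n/d : ¬ d ∣ suc n → suc n / d ≡ n / d
  suc[n]/d≡n/d d∤ with ℕ.m≤n⇒m<n∨m≡n (m%n<n n d)
  ... | inj₁ lt = begin
    suc n / d                         ≡⟨ /-congˡ decomposition ⟩
    (suc (n % d) + n / d * d) / d     ≡⟨ +-distrib-/-∣ʳ (suc (n % d)) (n∣m*n (n / d)) ⟩
    suc (n % d) / d + n / d * d / d   ≡⟨ cong₂ _+_ (m<n⇒m/n≡0 lt) (m*n/n≡m (n / d) d) ⟩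
    n / d                             ∎
  ... | inj₂ eq = contradiction (divides (suc (n / d)) (block-end eq)) d∤

div-suc : ∀ d n → n div d + length (filter (d ∣?_) (suc n ∷ [])) ≡ suc n div d
div-suc d n with d ∣? suc n
div-suc zero n | yes 0∣ = contradiction (0∣⇒≡0 0∣) ℕ.1+n≢0
div-suc zero n | no _ = refl
div-suc (suc k) n | yes d∣ = trans (ℕ.+-comm _ 1) (sym (suc[n]/d≡suc[n/d] n (suc k) d∣))
div-suc (suc k) n | no d∤ = trans (ℕ.+-identityʳ _) (sym (suc[n]/d≡n/d n (suc k) d∤))

length-filter-∣-range1 : ∀ d n → length (filter (d ∣?_) (range1 n)) ≡ n div d
length-filter-∣-range1 zero zero = refl
length-filter-∣-range1 (suc _) zero = refl
length-filter-∣-range1 d (suc n) = begin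
  length (filter (d ∣?_) (range1 (suc n)))
    ≡⟨ cong (length ∘ filter (d ∣?_)) (range1-suc n) ⟩
  length (filter (d ∣?_) (range1 n ++ suc n ∷ []))
    ≡⟨ length-filter-++ (d ∣?_) (range1 n) (suc n ∷ []) ⟩
  length (filter (d ∣?_) (range1 n)) + length (filter (d ∣?_) (suc n ∷ []))
    ≡⟨ cong (_+ length (filter (d ∣?_) (suc n ∷ []))) (length-filter-∣-range1 d n) ⟩
  n div d + length (filter (d ∣?_) (suc n ∷ []))
    ≡⟨ div-suc d n ⟩
  suc n div d ∎

module _ (g : ℕ → ℕ) {b : ℕ} where

  All-∣⇒lcmList-∣ : ∀ J → All (λ t → g t ∣ b) J → lcmList (map g J) ∣ b
  All-∣⇒lcmList-∣ [] [] = 1∣ b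
  All-∣⇒lcmList-∣ (t ∷ J) (g∣ ∷ gs∣) = lcm-least g∣ (All-∣⇒lcmList-∣ J gs∣)

  lcmList-∣⇒All-∣ : ∀ J → lcmList (map g J) ∣ b → All (λ t → g t ∣ b) J
  lcmList-∣⇒All-∣ [] _ = []
  lcmList-∣⇒All-∣ (t ∷ J) l∣ =
    ∣-trans (m∣lcm[m,n] _ _) l∣ ∷ lcmList-∣⇒All-∣ J (∣-trans (n∣lcm[m,n] (g t) _) l∣)

div≡/ : ∀ m n .{{_ : NonZero n}} → m div n ≡ m / n
div≡/ m (suc n) = refl

∣*⇔/gcd∣ : ∀ a t b .{{_ : NonZero a}} → a ∣ b * t ⇔ a div gcd a t ∣ b
∣*⇔/gcd∣ a t b = mk⇔ to from
  where
  instance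
    gcd≢0 : NonZero (gcd a t)
    gcd≢0 = ≢-nonZero (gcd[m,n]≢0 a t (inj₁ (≢-nonZero⁻¹ a)))

  to : a ∣ b * t → a div gcd a t ∣ b
  to a∣ = subst (_∣ b) (sym (div≡/ a (gcd a t)))
    (coprime-divisor (coprime-/gcd a t) (subst (a / gcd a t ∣_) (ℕ.*-comm b _) reduced))
    where
    bt≡ : b * t ≡ b * (t / gcd a t) * gcd a t
    bt≡ = trans (cong (b *_) (sym (m/n*n≡m (gcd[m,n]∣n a t)))) (sym (ℕ.*-assoc b _ _))
    reduced : a / gcd a t ∣ b * (t / gcd a t)
    reduced = m∣n*o⇒m/n∣o (gcd[m,n]∣m a t) (subst (a ∣_) bt≡ a∣)

  from : a div gcd a t ∣ b → a ∣ b * t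
  from q∣ = ∣-trans (m/n∣o⇒m∣o*n (gcd[m,n]∣m a t) (subst (_∣ b) (div≡/ a (gcd a t)) q∣))
    (*-monoʳ-∣ b (gcd[m,n]∣n a t))

f-nonZero : ∀ s r a .{{_ : NonZero r}} .{{_ : NonZero a}} → NonZero (f s r a)
f-nonZero s (suc r) a = ℕ.m*n≢0 a (s * a + suc r)
  where
  instance
    sa+r≢0 : NonZero (s * a + suc r)
    sa+r≢0 = ≢-nonZero (ℕ.m+1+n≢0 (s * a))

module _ (N s r : ℕ) .{{_ : NonZero r}} (a : ℕ) .{{_ : NonZero a}} where

  private
    instance
      fa≢0 : NonZero (f s r a)
      fa≢0 = f-nonZero s r a

    open InclusionExclusion {P = λ t b → m s r a t ∣ b} (λ t b → m s r a t ∣? b)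

  #good-b :
    + length (filter (λ b → good? s r (a , b)) (range1 N)) ≡
    sumℤ (map (λ J → sign (length J) ℤ.* + (N div lcmList (map (m s r a) J))) (subsets (range1 (a ∸ 1))))
  #good-b = begin
    + length (filter (λ b → good? s r (a , b)) (range1 N))
      ≡⟨ cong (+_ ∘ length) (filter-≐ (λ b → good? s r (a , b)) (noneOf? L) (good⇒noneOf , noneOf⇒good) (range1 N)) ⟩
    + #NoneOf L (range1 N)
      ≡⟨ inclusion-exclusion L (range1 N) ⟩
    sumℤ (map (signedCount (range1 N)) (subsets L))
      ≡⟨ cong sumℤ (map-cong (λ J → cong (λ n → sign (length J) ℤ.* + n) (#AllOf≡ J)) (subsets L)) ⟩
    sumℤ (map (λ J → sign (length J) ℤ.* + (N div lcmList (map (m s r a) J))) (subsets L)) ∎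
    where
    L = range1 (a ∸ 1)
    divides⇔ : ∀ t b → f s r a ∣ b * f s r t ⇔ m s r a t ∣ b
    divides⇔ t b = ∣*⇔/gcd∣ (f s r a) (f s r t) b
    good⇒noneOf : ∀ {b} → Good s r (a , b) → NoneOf L b
    good⇒noneOf {b} = All.map λ {t} ∤ m∣ → ∤ (Equivalence.from (divides⇔ t b) m∣)
    noneOf⇒good : ∀ {b} → NoneOf L b → Good s r (a , b)
    noneOf⇒good {b} = All.map λ {t} ∤ f∣ → ∤ (Equivalence.to (divides⇔ t b) f∣)
    #AllOf≡ : ∀ J → #AllOf J (range1 N) ≡ N div lcmList (map (m s r a) J)
    #AllOf≡ J = trans
      (cong length (filter-≐ (allOf? J) (lcmList (map (m s r a) J) ∣?_)
        (All-∣⇒lcmList-∣ (m s r a) J , lcmList-∣⇒All-∣ (m s r a) J) (range1 N)))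
      (length-filter-∣-range1 (lcmList (map (m s r a) J)) N)

theorem3p8 : (N s r : ℕ) → 1 < N → 1 ≤ s → 1 ≤ r →
    + count N s r ≡ formula N s r
theorem3p8 N s r _ _ 1≤r = begin
  + count N s r
    ≡⟨ length-filter-cartesianProduct (good? s r) (range1 N) (range1 N) ⟩
  sumℤ (map (λ a → + length (filter (λ b → good? s r (a , b)) (range1 N))) (range1 N))
    ≡⟨ cong sumℤ (map-cong-range1 (λ k → #good-b N s r (suc k)) N) ⟩
  formula N s r ∎
  where
  instance
    r≢0 : NonZero r
    r≢0 = >-nonZero 1≤r
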